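{- There are terms $\mathbf{Coerc},\mathbf{Add},\mathbf{Square}$ such that for all $n,m\in\mathbb{N}$: $\mathbf{Coerc}\,\ulcorner n\urcorner\leadsto^*\ulcorner n\urcorner$, $\mathbf{Add}\,\ulcorner n\urcorner\,\ulcorner m\urcorner\leadsto^*\ulcorner n+m\urcorner$, $\mathbf{Square}\,\ulcorner n\urcorner\leadsto^*\ulcorner n^2\urcorner$; and for every $i\in\mathbb{N}$ the following are derivable in $\mathsf{RH}(\emptyset)$: $\vdash\mathbf{Coerc}:\mathbb{U}^{i+1}\multimap\mathbb{U}^i$, $\vdash\mathbf{Add}:\mathbb{U}^{i+1}\multimap\mathbb{U}^i\multimap\mathbb{U}^i$, $\vdash\mathbf{Square}:\mathbb{U}^{i+2}\multimap\mathbb{U}^i$.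
   Context: Free algebras: a free algebra $\mathbb{A}=(\mathcal{C}_\mathbb{A},\mathcal{R}_\mathbb{A})$: finite constructor set $\{c^\mathbb{A}_1,\dots,c^\mathbb{A}_{k(\mathbb{A})}\}$ with arities. $\mathscr{A}$ is a fixed finite family of free algebras with pairwise disjoint constructor sets containing: $\mathbb{U}$ ($c_1^\mathbb{U}$ unary, $c_2^\mathbb{U}$ nullary), $\mathbb{B}$ ($c_1^\mathbb{B},c_2^\mathbb{B}$ unary, $c_3^\mathbb{B}$ nullary), $\mathbb{C}$ ($c_1^\mathbb{C}$ binary, $c_2^\mathbb{C}$ nullary), $\mathbb{D}$ ($c_1^\mathbb{D},c_2^\mathbb{D}$ binary, $c_3^\mathbb{D}$ nullary). Numerals: $\ulcorner 0\urcorner=c_2^\mathbb{U}$, $\ulcorner n+1\urcorner=c_1^\mathbb{U}\ulcorner n\urcorner$. Terms: $M::=x\mid c\mid MM\mid \lambda x.M\mid M\{\!\{M,\dots,M\}\!\}\mid M\langle\!\langle M,\dots,M\rangle\!\rangle$. Types: $A::=\mathbb{A}^n\mid A\multimap A$. $A\multimap^0B=B$, $A\multimap^{n+1}B=A\multimap(A\multimap^nB)$; level $V(\mathbb{A}^n)=n$, $V(A\multimap B)=\max\{V(A),V(B)\}$. Typing rules: (A) $x:A\vdash x:A$; (W) from $\Gamma\vdash M:B$ infer $\Gamma,x:A\vdash M:B$; (C) from $\Gamma,x:A,y:A\vdash M:B$ infer $\Gamma,z:A\vdash M\{z/x,z/y\}:B$; ($I_\multimap$) from $\Gamma,x:A\vdash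 M:B$ infer $\Gamma\vdash\lambda x.M:A\multimap B$; ($E_\multimap$) from $\Gamma\vdash M:A\multimap B$, $\Delta\vdash N:A$ infer $\Gamma,\Delta\vdash MN:B$; ($I_\mathbb{A}$) $\vdash c:\mathbb{A}^n\multimap^{\mathcal{R}(c)}\mathbb{A}^n$; ($E^C_\mathbb{A}$) from $\Gamma_i\vdash M_{c^\mathbb{A}_i}:\mathbb{A}^m\multimap^{\mathcal{R}(c^\mathbb{A}_i)}C$ and $\Delta\vdash L:\mathbb{A}^m$ infer $\Gamma_1,\dots,\Gamma_{k(\mathbb{A})},\Delta\vdash L\{\!\{M_{c_1^\mathbb{A}},\dots\}\!\}:C$; ($E^R_\mathbb{A}$) from $\Gamma_i\vdash M_{c^\mathbb{A}_i}:\mathbb{A}^m\multimap^{\mathcal{R}(c^\mathbb{A}_i)}(C\multimap^{\mathcal{R}(c^\mathbb{A}_i)}C)$ and $\Delta\vdash L:\mathbb{A}^m$ infer $\Gamma_1,\dots,\Gamma_{k(\mathbb{A})},\Delta\vdash L\langle\!\langle M_{c_1^\mathbb{A}},\dots\rangle\!\rangle:C$. The system $\mathsf{RH}(\emptyset)$ uses these rules but never allows rule (C), requires all $\Gamma_i$ in $E^R_\mathbb{A}$ to be empty, and adds to $E^R_\mathbb{A}$ the premise $m>V(C)$. Values $V::=x\mid\lambda x.M\mid T$, $T::=c\mid TT$. Reduction $\to$: $(\lambda x.M)V\to M\{V/x\}$; $c_i^\mathbb{A}t_1\cdots t_r\{\!\{M_{c_1},\dots,M_{c_k}\}\!\}\to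 M_{c_i}t_1\cdots t_r$; $c_i^\mathbb{A}t_1\cdots t_r\langle\!\langle\vec M\rangle\!\rangle\to M_{c_i}t_1\cdots t_r(t_1\langle\!\langle\vec M\rangle\!\rangle)\cdots(t_r\langle\!\langle\vec M\rangle\!\rangle)$ with $r=\mathcal{R}(c_i^\mathbb{A})$, $t_j$ constructor terms. $\leadsto$ is the closure of $\to$ under application contexts on both sides and under the scrutinee position of conditionals/recursions (not under $\lambda$, not inside branches); $\leadsto^*$ its reflexive-transitive closure. -}

module Defs where

open import Data.Nat using (ℕ; zero; suc; _⊔_; _<_)
open import Data.Fin using (Fin; zero; suc; toℕ)
open import Data.List using (List; []; _∷_; length; lookup; map; _++_)
open import Data.List.Relation.Unary.All using (All)
open import Data.Vec using (Vec; []; _∷_; replicate; _[_]≔_) renaming (lookup to vlookup)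
open import Data.Maybe using (Maybe; just; nothing)
open import Data.Product using (Σ; _,_; proj₁)
open import Relation.Binary.PropositionalEquality using (_≡_)
open import Relation.Binary.Construct.Closure.ReflexiveTransitive using (Star)

-- A finite family of free algebras: each algebra is given by the list of the
-- arities of its constructors c_1, ..., c_k (in order).  Constructors are pairs
-- (algebra index, constructor index), so constructor sets are disjoint.
Family : Set
Family = List (List ℕ)

nth : {A : Set} → List A → ℕ → Maybe A
nth [] _ = nothing
nth (x ∷ xs) zero = just x
nth (x ∷ xs) (suc k) = nth xs k

module _ (fam : Family) where

  Alg : Set
  Alg = Fin (length fam)

  Con : Set
  Con = Σ Alg (λ a → Fin (length (lookup fam a)))

  arity : Con → ℕ
  arity (a , i) = lookup (lookup fam a) i

  data Ty : Set where
    alg : Alg → ℕ → Ty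
    _⊸_ : Ty → Ty → Ty

  infixr 5 _⊸_

  _⊸[_]_ : Ty → ℕ → Ty → Ty
  A ⊸[ zero ] B = B
  A ⊸[ suc n ] B = A ⊸ (A ⊸[ n ] B)

  level : Ty → ℕ
  level (alg a n) = n
  level (A ⊸ B) = level A ⊔ level B

  data Tm (n : ℕ) : Set where
    var  : Fin n → Tm n
    con  : Con → Tm n
    app  : Tm n → Tm n → Tm n
    lam  : Tm (suc n) → Tm n
    case : Tm n → List (Tm n) → Tm n
    rec  : Tm n → List (Tm n) → Tm n

  ext : {n m : ℕ} → (Fin n → Fin m) → Fin (suc n) → Fin (suc m)
  ext ρ zero = zero
  ext ρ (suc i) = suc (ρ i)

  mutual
    ren : {n m : ℕ} → (Fin n → Fin m) → Tm n → Tm m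
    ren ρ (var i) = var (ρ i)
    ren ρ (con c) = con c
    ren ρ (app M N) = app (ren ρ M) (ren ρ N)
    ren ρ (lam M) = lam (ren (ext ρ) M)
    ren ρ (case L ms) = case (ren ρ L) (renL ρ ms)
    ren ρ (rec L ms) = rec (ren ρ L) (renL ρ ms)

    renL : {n m : ℕ} → (Fin n → Fin m) → List (Tm n) → List (Tm m)
    renL ρ [] = []
    renL ρ (M ∷ ms) = ren ρ M ∷ renL ρ ms

  exts : {n m : ℕ} → (Fin n → Tm m) → Fin (suc n) → Tm (suc m)
  exts σ zero = var zero
  exts σ (suc i) = ren suc (σ i)

  mutual
    sub : {n m : ℕ} → (Fin n → Tm m) → Tm n → Tm m
    sub σ (var i) = σ i
    sub σ (con c) = con c
    sub σ (app M N) = app (sub σ M) (sub σ N)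
    sub σ (lam M) = lam (sub (exts σ) M)
    sub σ (case L ms) = case (sub σ L) (subL σ ms)
    sub σ (rec L ms) = rec (sub σ L) (subL σ ms)

    subL : {n m : ℕ} → (Fin n → Tm m) → List (Tm n) → List (Tm m)
    subL σ [] = []
    subL σ (M ∷ ms) = sub σ M ∷ subL σ ms

  _[_]₀ : {n : ℕ} → Tm (suc n) → Tm n → Tm n
  M [ V ]₀ = sub (λ { zero → V ; (suc i) → var i }) M

  apps : {n : ℕ} → Tm n → List (Tm n) → Tm n
  apps M [] = M
  apps M (t ∷ ts) = apps (app M t) ts

  data IsCT {n : ℕ} : Tm n → Set where
    ct-con : (c : Con) → IsCT (con c)
    ct-app : {T S : Tm n} → IsCT T → IsCT S → IsCT (app T S)

  data IsVal {n : ℕ} : Tm n → Set where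
    v-var : (i : Fin n) → IsVal (var i)
    v-lam : (M : Tm (suc n)) → IsVal (lam M)
    v-ct  : {T : Tm n} → IsCT T → IsVal T

  data _⟶_ {n : ℕ} : Tm n → Tm n → Set where
    β : {M : Tm (suc n)} {V : Tm n} → IsVal V → app (lam M) V ⟶ (M [ V ]₀)
    ι-case : (a : Alg) (i : Fin (length (lookup fam a))) (ts ms : List (Tm n)) (M : Tm n) →
             All IsCT ts → length ts ≡ arity (a , i) → nth ms (toℕ i) ≡ just M →
             case (apps (con (a , i)) ts) ms ⟶ apps M ts
    ι-rec : (a : Alg) (i : Fin (length (lookup fam a))) (ts ms : List (Tm n)) (M : Tm n) →
            All IsCT ts → length ts ≡ arity (a , i) → nth ms (toℕ i) ≡ just M →
            rec (apps (con (a , i)) ts) ms ⟶ apps M (ts ++ map (λ t → rec t ms) ts)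

  data _⇝_ {n : ℕ} : Tm n → Tm n → Set where
    base  : {M N : Tm n} → M ⟶ N → M ⇝ N
    appˡ  : {M M' N : Tm n} → M ⇝ M' → app M N ⇝ app M' N
    appʳ  : {M N N' : Tm n} → N ⇝ N' → app M N ⇝ app M N'
    caseˢ : {L L' : Tm n} {ms : List (Tm n)} → L ⇝ L' → case L ms ⇝ case L' ms
    recˢ  : {L L' : Tm n} {ms : List (Tm n)} → L ⇝ L' → rec L ms ⇝ rec L' ms

  _⇝*_ : {n : ℕ} → Tm n → Tm n → Set
  _⇝*_ = Star _⇝_

  ---------------------------------------------------------------- typing in RH(∅)
  -- context for a term with n free (de Bruijn) variables: position i holds
  -- just A if the variable i : A is in the context, nothing otherwise.
  Ctx : ℕ → Set
  Ctx n = Vec (Maybe Ty) n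

  ε : {n : ℕ} → Ctx n
  ε = replicate _ nothing

  data _≔_⊎_ : {n : ℕ} → Ctx n → Ctx n → Ctx n → Set where
    []    : [] ≔ [] ⊎ []
    left  : {n : ℕ} {Θ Γ Δ : Ctx n} {A : Ty} → Θ ≔ Γ ⊎ Δ →
            (just A ∷ Θ) ≔ (just A ∷ Γ) ⊎ (nothing ∷ Δ)
    right : {n : ℕ} {Θ Γ Δ : Ctx n} {A : Ty} → Θ ≔ Γ ⊎ Δ →
            (just A ∷ Θ) ≔ (nothing ∷ Γ) ⊎ (just A ∷ Δ)
    none  : {n : ℕ} {Θ Γ Δ : Ctx n} → Θ ≔ Γ ⊎ Δ →
            (nothing ∷ Θ) ≔ (nothing ∷ Γ) ⊎ (nothing ∷ Δ)

  mutual
    data _⊢_⦂_ {n : ℕ} : Ctx n → Tm n → Ty → Set where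
      ax   : (i : Fin n) (A : Ty) → (ε [ i ]≔ just A) ⊢ var i ⦂ A
      weak : {Γ : Ctx n} {M : Tm n} {B : Ty} (i : Fin n) (A : Ty) →
             Γ ⊢ M ⦂ B → vlookup Γ i ≡ nothing → (Γ [ i ]≔ just A) ⊢ M ⦂ B
      lam  : {Γ : Ctx n} {M : Tm (suc n)} {A B : Ty} →
             (just A ∷ Γ) ⊢ M ⦂ B → Γ ⊢ lam M ⦂ (A ⊸ B)
      app  : {Γ Δ Θ : Ctx n} {M N : Tm n} {A B : Ty} →
             Γ ⊢ M ⦂ (A ⊸ B) → Δ ⊢ N ⦂ A → Θ ≔ Γ ⊎ Δ → Θ ⊢ app M N ⦂ B
      con  : (c : Con) (m : ℕ) →
             ε ⊢ con c ⦂ (alg (proj₁ c) m ⊸[ arity c ] alg (proj₁ c) m)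
      case : {Γ Δ Θ : Ctx n} {L : Tm n} {ms : List (Tm n)} {C : Ty} (a : Alg) (m : ℕ) →
             BrC Γ ms (lookup fam a) a m C → Δ ⊢ L ⦂ alg a m → Θ ≔ Γ ⊎ Δ →
             Θ ⊢ case L ms ⦂ C
      rec  : {Δ : Ctx n} {L : Tm n} {ms : List (Tm n)} {C : Ty} (a : Alg) (m : ℕ) →
             BrR ms (lookup fam a) a m C → Δ ⊢ L ⦂ alg a m → level C < m →
             Δ ⊢ rec L ms ⦂ C

    data BrC {n : ℕ} : Ctx n → List (Tm n) → List ℕ → Alg → ℕ → Ty → Set where
      []  : {a : Alg} {m : ℕ} {C : Ty} → BrC ε [] [] a m C
      _∷_ : {Γ Γ' Θ : Ctx n} {M : Tm n} {ms : List (Tm n)} {r : ℕ} {rs : List ℕ}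
            {a : Alg} {m : ℕ} {C : Ty} →
            Γ ⊢ M ⦂ (alg a m ⊸[ r ] C) → BrC Γ' ms rs a m C → Θ ≔ Γ ⊎ Γ' →
            BrC Θ (M ∷ ms) (r ∷ rs) a m C

    data BrR {n : ℕ} : List (Tm n) → List ℕ → Alg → ℕ → Ty → Set where
      []  : {a : Alg} {m : ℕ} {C : Ty} → BrR [] [] a m C
      _∷_ : {M : Tm n} {ms : List (Tm n)} {r : ℕ} {rs : List ℕ}
            {a : Alg} {m : ℕ} {C : Ty} →
            ε ⊢ M ⦂ (alg a m ⊸[ r ] (C ⊸[ r ] C)) → BrR ms rs a m C →
            BrR (M ∷ ms) (r ∷ rs) a m C

---------------------------------------------------------------- the family 𝒜
-- 𝒜 contains 𝕌, 𝔹, ℂ, 𝔻 (in this order) followed by arbitrary further algebras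
𝒜 : List (List ℕ) → Family
𝒜 rest = (1 ∷ 0 ∷ []) ∷ (1 ∷ 1 ∷ 0 ∷ []) ∷ (2 ∷ 0 ∷ []) ∷ (2 ∷ 2 ∷ 0 ∷ []) ∷ rest

𝕌 : {rest : List (List ℕ)} → Alg (𝒜 rest)
𝕌 = zero

U^ : {rest : List (List ℕ)} → ℕ → Ty (𝒜 rest)
U^ {rest} i = alg (𝕌 {rest}) i

⌜_⌝ : {rest : List (List ℕ)} {n : ℕ} → ℕ → Tm (𝒜 rest) n
⌜ zero ⌝ = con (zero , suc zero)
⌜ suc k ⌝ = app (con (zero , zero)) ⌜ k ⌝

{-# OPTIONS --safe #-}
-- Each term iterates a step by safe recursion on its argument, so on numerals it reduces by
-- induction (rec-⌜⌝).  The recursion in Add ⌜n⌝ yields the n-fold successor λz. S(⋯(S z)) (plus n);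
-- the one in Square ⌜n⌝ yields a function adding 2k+1 for every k < n to its argument
-- (addSquare n), and n² = Σ_{k<n} (2k+1).  Contraction being unavailable, 2k+1 is not k+k+1 but
-- is computed by a separate recursion Double on k, which costs the extra level in 𝕌^(i+2).
module Submission where

open import Defs
open import Data.Nat using (ℕ; zero; suc; _+_; _*_; _^_; _<_)
open import Data.Nat.Properties using (⊔-idem; n<1+n; m<n⇒m<1+n; +-identityʳ; ^-identityʳ)
open import Data.Nat.Tactic.RingSolver using (solve-∀)
open import Data.Fin using (Fin; zero; suc)
open import Data.List using (List; []; _∷_)
open import Data.List.Relation.Unary.All using ([]; _∷_)
open import Data.Maybe using (just; nothing)
open import Data.Product using (Σ-syntax; _×_; _,_)
open import Data.Vec using ([]; _∷_)
open import Relation.Binary.PropositionalEquality using (_≡_; refl; cong; cong₂; trans; sym; subst)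
open import Relation.Binary.Construct.Closure.ReflexiveTransitive as Star using (_◅_; _◅◅_; gmap)

module Arithmetic (rest : List (List ℕ)) where

  F : Family
  F = 𝒜 rest

  Term : ℕ → Set
  Term = Tm F

  U : ℕ → Ty F
  U = U^ {rest}

  sucᵁ zeroᵁ identity : ∀ {n} → Term n
  sucᵁ = con (zero , zero)
  zeroᵁ = con (zero , suc zero)
  identity = lam (var zero)

  sucAfter : ∀ {n} → Term (suc n) → Term n
  sucAfter r = lam (app sucᵁ (app r (var zero)))

  coercStep doubleStep addStep squareStep : ∀ {n} → Term n
  Coerc Double Add Square : ∀ {n} → Term n

  addOdd : ∀ {n} → Term (suc n) → Term (suc n) → Term n
  addOdd r p = lam (app r (app (app Add (app sucᵁ (app Double p))) (var zero)))

  coercStep = lam (lam (app sucᵁ (var zero)))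
  Coerc = lam (rec (var zero) (coercStep ∷ zeroᵁ ∷ []))

  doubleStep = lam (lam (app sucᵁ (app sucᵁ (var zero))))
  Double = lam (rec (var zero) (doubleStep ∷ zeroᵁ ∷ []))

  addStep = lam (lam (sucAfter (var (suc zero))))
  Add = lam (lam (app (rec (var (suc zero)) (addStep ∷ identity ∷ [])) (var zero)))

  squareStep = lam (lam (addOdd (var (suc zero)) (var (suc (suc zero)))))
  Square = lam (app (rec (var zero) (squareStep ∷ identity ∷ [])) zeroᵁ)

  plus addSquare : ∀ {n} → ℕ → Term n
  plus zero = identity
  plus (suc k) = sucAfter (plus k)

  addSquare zero = identity
  addSquare (suc k) = addOdd (addSquare k) ⌜ k ⌝

  ren-⌜⌝ : ∀ {n m} (ρ : Fin n → Fin m) k → ren F ρ ⌜ k ⌝ ≡ ⌜ k ⌝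
  ren-⌜⌝ ρ zero = refl
  ren-⌜⌝ ρ (suc k) = cong (app sucᵁ) (ren-⌜⌝ ρ k)

  sub-⌜⌝ : ∀ {n m} (σ : Fin n → Term m) k → sub F σ ⌜ k ⌝ ≡ ⌜ k ⌝
  sub-⌜⌝ σ zero = refl
  sub-⌜⌝ σ (suc k) = cong (app sucᵁ) (sub-⌜⌝ σ k)

  ren-plus : ∀ {n m} (ρ : Fin n → Fin m) k → ren F ρ (plus k) ≡ plus k
  ren-plus ρ zero = refl
  ren-plus ρ (suc k) = cong sucAfter (ren-plus (ext F ρ) k)

  sub-plus : ∀ {n m} (σ : Fin n → Term m) k → sub F σ (plus k) ≡ plus k
  sub-plus σ zero = refl
  sub-plus σ (suc k) = cong sucAfter (sub-plus (exts F σ) k)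

  ren-addSquare : ∀ {n m} (ρ : Fin n → Fin m) k → ren F ρ (addSquare k) ≡ addSquare k
  ren-addSquare ρ zero = refl
  ren-addSquare ρ (suc k) = cong₂ addOdd (ren-addSquare (ext F ρ) k) (ren-⌜⌝ (ext F ρ) k)

  sub-addSquare : ∀ {n m} (σ : Fin n → Term m) k → sub F σ (addSquare k) ≡ addSquare k
  sub-addSquare σ zero = refl
  sub-addSquare σ (suc k) = cong₂ addOdd (sub-addSquare (exts F σ) k) (sub-⌜⌝ (exts F σ) k)

  _↝_ _↝*_ : Term 0 → Term 0 → Set
  _↝_ = _⇝_ F
  _↝*_ = _⇝*_ F

  ⌜⌝-isCT : ∀ {n} k → IsCT F {n} ⌜ k ⌝
  ⌜⌝-isCT zero = ct-con _
  ⌜⌝-isCT (suc k) = ct-app (ct-con _) (⌜⌝-isCT k)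

  ⌜⌝-isVal : ∀ k → IsVal F {0} ⌜ k ⌝
  ⌜⌝-isVal k = v-ct (⌜⌝-isCT k)

  plus-isVal : ∀ k → IsVal F {0} (plus k)
  plus-isVal zero = v-lam _
  plus-isVal (suc k) = v-lam _

  addSquare-isVal : ∀ k → IsVal F {0} (addSquare k)
  addSquare-isVal zero = v-lam _
  addSquare-isVal (suc k) = v-lam _

  β-≡ : ∀ {M : Term 1} {V N : Term 0} → IsVal F V → _[_]₀ F M V ≡ N → app (lam M) V ↝ N
  β-≡ v refl = base (β v)

  appˡ* : ∀ {M M' N : Term 0} → M ↝* M' → app M N ↝* app M' N
  appˡ* = gmap _ appˡ

  appʳ* : ∀ {M N N' : Term 0} → N ↝* N' → app M N ↝* app M N'
  appʳ* = gmap _ appʳ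

  ↝*-⌜⌝-≡ : ∀ {M a b} → M ↝* ⌜ a ⌝ → a ≡ b → M ↝* ⌜ b ⌝
  ↝*-⌜⌝-≡ r refl = r

  rec-⌜⌝ : (step : Term 0) (R : ℕ → Term 0) →
    (∀ k → app (app step ⌜ k ⌝) (R k) ↝* R (suc k)) →
    ∀ k → rec ⌜ k ⌝ (step ∷ R 0 ∷ []) ↝* R k
  rec-⌜⌝ step R step↝ zero = base (ι-rec zero (suc zero) [] _ _ [] refl refl) ◅ Star.ε
  rec-⌜⌝ step R step↝ (suc k) =
    base (ι-rec zero zero (⌜ k ⌝ ∷ []) _ step (⌜⌝-isCT k ∷ []) refl refl)
    ◅ appʳ* (rec-⌜⌝ step R step↝ k) ◅◅ step↝ k

  Coerc-⌜⌝ : ∀ n → app Coerc ⌜ n ⌝ ↝* ⌜ n ⌝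
  Coerc-⌜⌝ n = β-≡ (⌜⌝-isVal n) refl ◅ rec-⌜⌝ coercStep ⌜_⌝ step n
    where
    step : ∀ k → app (app coercStep ⌜ k ⌝) ⌜ k ⌝ ↝* ⌜ suc k ⌝
    step k = appˡ (β-≡ (⌜⌝-isVal k) refl) ◅ β-≡ (⌜⌝-isVal k) refl ◅ Star.ε

  Double-⌜⌝ : ∀ n → app Double ⌜ n ⌝ ↝* ⌜ n * 2 ⌝
  Double-⌜⌝ n = β-≡ (⌜⌝-isVal n) refl ◅ rec-⌜⌝ doubleStep (λ k → ⌜ k * 2 ⌝) step n
    where
    step : ∀ k → app (app doubleStep ⌜ k ⌝) ⌜ k * 2 ⌝ ↝* ⌜ suc k * 2 ⌝
    step k = appˡ (β-≡ (⌜⌝-isVal k) refl) ◅ β-≡ (⌜⌝-isVal (k * 2)) refl ◅ Star.ε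

  plus-⌜⌝ : ∀ k m → app (plus k) ⌜ m ⌝ ↝* ⌜ k + m ⌝
  plus-⌜⌝ zero m = β-≡ (⌜⌝-isVal m) refl ◅ Star.ε
  plus-⌜⌝ (suc k) m =
    β-≡ (⌜⌝-isVal m) (cong (λ f → app sucᵁ (app f ⌜ m ⌝)) (sub-plus _ k)) ◅ appʳ* (plus-⌜⌝ k m)

  Add-⌜⌝ : ∀ n m → app (app Add ⌜ n ⌝) ⌜ m ⌝ ↝* ⌜ n + m ⌝
  Add-⌜⌝ n m =
    appˡ (β-≡ (⌜⌝-isVal n) (cong (λ t → lam (app (rec t branches) (var zero))) (ren-⌜⌝ suc n)))
    ◅ β-≡ (⌜⌝-isVal m) (cong (λ t → app (rec t branches) ⌜ m ⌝) (sub-⌜⌝ _ n))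
    ◅ appˡ* (rec-⌜⌝ addStep plus step n) ◅◅ plus-⌜⌝ n m
    where
    branches : ∀ {n} → List (Term n)
    branches = addStep ∷ identity ∷ []
    step : ∀ k → app (app addStep ⌜ k ⌝) (plus k) ↝* plus (suc k)
    step k = appˡ (β-≡ (⌜⌝-isVal k) refl)
      ◅ β-≡ (plus-isVal k) (cong sucAfter (ren-plus suc k)) ◅ Star.ε

  addSquare-⌜⌝ : ∀ k m → app (addSquare k) ⌜ m ⌝ ↝* ⌜ m + k * k ⌝
  addSquare-⌜⌝ zero m = β-≡ (⌜⌝-isVal m) (cong ⌜_⌝ (sym (+-identityʳ m))) ◅ Star.ε
  addSquare-⌜⌝ (suc k) m =
    β-≡ (⌜⌝-isVal m) (cong₂ (λ r p → app r (app (app Add (app sucᵁ (app Double p))) ⌜ m ⌝))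
                            (sub-addSquare _ k) (sub-⌜⌝ _ k))
    ◅ appʳ* (appˡ* (appʳ* (appʳ* (Double-⌜⌝ k))) ◅◅ Add-⌜⌝ (suc (k * 2)) m)
    ◅◅ ↝*-⌜⌝-≡ (addSquare-⌜⌝ k (suc (k * 2) + m)) (odd-step k m)
    where
    odd-step : ∀ k m → suc (k * 2) + m + k * k ≡ m + suc k * suc k
    odd-step = solve-∀

  Square-⌜⌝ : ∀ n → app Square ⌜ n ⌝ ↝* ⌜ n ^ 2 ⌝
  Square-⌜⌝ n = β-≡ (⌜⌝-isVal n) refl
    ◅ appˡ* (rec-⌜⌝ squareStep addSquare step n)
    ◅◅ ↝*-⌜⌝-≡ (addSquare-⌜⌝ n 0) (cong (n *_) (sym (^-identityʳ n)))
    where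
    step : ∀ k → app (app squareStep ⌜ k ⌝) (addSquare k) ↝* addSquare (suc k)
    step k = appˡ (β-≡ (⌜⌝-isVal k) (cong (λ p → lam (addOdd (var (suc zero)) p))
                                         (trans (cong (ren F suc) (ren-⌜⌝ suc k)) (ren-⌜⌝ suc k))))
      ◅ β-≡ (addSquare-isVal k) (cong₂ addOdd (ren-addSquare suc k) (sub-⌜⌝ _ k)) ◅ Star.ε

  ∅ : ∀ {n} → Ctx F n
  ∅ = ε F

  _⊩_⦂_ : ∀ {n} → Ctx F n → Term n → Ty F → Set
  Γ ⊩ M ⦂ A = _⊢_⦂_ F Γ M A

  ∅⊎ : ∀ {n} (Γ : Ctx F n) → _≔_⊎_ F Γ ∅ Γ
  ∅⊎ [] = []
  ∅⊎ (just A ∷ Γ) = right (∅⊎ Γ)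
  ∅⊎ (nothing ∷ Γ) = none (∅⊎ Γ)

  ⊎∅ : ∀ {n} (Γ : Ctx F n) → _≔_⊎_ F Γ Γ ∅
  ⊎∅ [] = []
  ⊎∅ (just A ∷ Γ) = left (⊎∅ Γ)
  ⊎∅ (nothing ∷ Γ) = none (⊎∅ Γ)

  app-closed : ∀ {n} {Γ : Ctx F n} {M N A B} → ∅ ⊩ M ⦂ (A ⊸ B) → Γ ⊩ N ⦂ A → Γ ⊩ app M N ⦂ B
  app-closed ⊢M ⊢N = app ⊢M ⊢N (∅⊎ _)

  weaken₀ : ∀ {n} {Γ : Ctx F n} {M A B} → (nothing ∷ Γ) ⊩ M ⦂ B → (just A ∷ Γ) ⊩ M ⦂ B
  weaken₀ {A = A} ⊢M = weak zero A ⊢M refl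

  ⊢sucᵁ : ∀ {n} {Γ : Ctx F n} {M} i → Γ ⊩ M ⦂ U i → Γ ⊩ app sucᵁ M ⦂ U i
  ⊢sucᵁ i = app-closed (con (zero , zero) i)

  ⊢zeroᵁ : ∀ {n} i → ∅ {n} ⊩ zeroᵁ ⦂ U i
  ⊢zeroᵁ i = con (zero , suc zero) i

  ⊢identity : ∀ {n} A → ∅ {n} ⊩ identity ⦂ (A ⊸ A)
  ⊢identity A = lam (ax zero A)

  level-U⊸U : ∀ {i j} → i < j → level F (U i ⊸ U i) < j
  level-U⊸U {i} = subst (_< _) (sym (⊔-idem i))

  ⊢sucAfter : ∀ {n} {Γ : Ctx F n} {r} i → (nothing ∷ Γ) ⊩ r ⦂ (U i ⊸ U i) → Γ ⊩ sucAfter r ⦂ (U i ⊸ U i)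
  ⊢sucAfter {Γ = Γ} i ⊢r = lam (⊢sucᵁ i (app ⊢r (ax zero (U i)) (right (⊎∅ Γ))))

  ⊢Coerc : ∀ {n} i → ∅ {n} ⊩ Coerc ⦂ (U (suc i) ⊸ U i)
  ⊢Coerc i = lam (rec zero (suc i) (⊢step ∷ ⊢zeroᵁ i ∷ []) (ax zero (U (suc i))) (n<1+n i))
    where
    ⊢step : ∅ ⊩ coercStep ⦂ (U (suc i) ⊸ (U i ⊸ U i))
    ⊢step = lam (weaken₀ (lam (⊢sucᵁ i (ax zero (U i)))))

  ⊢Double : ∀ {n} i → ∅ {n} ⊩ Double ⦂ (U (suc i) ⊸ U i)
  ⊢Double i = lam (rec zero (suc i) (⊢step ∷ ⊢zeroᵁ i ∷ []) (ax zero (U (suc i))) (n<1+n i))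
    where
    ⊢step : ∅ ⊩ doubleStep ⦂ (U (suc i) ⊸ (U i ⊸ U i))
    ⊢step = lam (weaken₀ (lam (⊢sucᵁ i (⊢sucᵁ i (ax zero (U i))))))

  ⊢Add : ∀ {n} i → ∅ {n} ⊩ Add ⦂ (U (suc i) ⊸ (U i ⊸ U i))
  ⊢Add i = lam (lam (app (rec zero (suc i) (⊢step ∷ ⊢identity (U i) ∷ [])
                              (ax (suc zero) (U (suc i))) (level-U⊸U (n<1+n i)))
                         (ax zero (U i)) (right (left (∅⊎ ∅)))))
    where
    ⊢step : ∅ ⊩ addStep ⦂ (U (suc i) ⊸ ((U i ⊸ U i) ⊸ (U i ⊸ U i)))
    ⊢step = lam (weaken₀ (lam (⊢sucAfter i (ax (suc zero) (U i ⊸ U i)))))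

  ⊢addOdd : ∀ {n} {Θ Γ Δ : Ctx F n} {r p} i → _≔_⊎_ F Θ Γ Δ →
    (nothing ∷ Γ) ⊩ r ⦂ (U i ⊸ U i) → (nothing ∷ Δ) ⊩ p ⦂ U (suc (suc i)) →
    Θ ⊩ addOdd r p ⦂ (U i ⊸ U i)
  ⊢addOdd {Δ = Δ} i Θ=Γ⊎Δ ⊢r ⊢p =
    lam (app ⊢r (app (app-closed (⊢Add i) (⊢sucᵁ (suc i) (app-closed (⊢Double (suc i)) ⊢p)))
                     (ax zero (U i)) (right (⊎∅ Δ)))
             (right Θ=Γ⊎Δ))

  ⊢Square : ∀ {n} i → ∅ {n} ⊩ Square ⦂ (U (suc (suc i)) ⊸ U i)
  ⊢Square i = lam (app (rec zero (suc (suc i)) (⊢step ∷ ⊢identity (U i) ∷ [])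
                            (ax zero (U (suc (suc i)))) (level-U⊸U (m<n⇒m<1+n (n<1+n i))))
                       (⊢zeroᵁ i) (left (∅⊎ ∅)))
    where
    ⊢step : ∅ ⊩ squareStep ⦂ (U (suc (suc i)) ⊸ ((U i ⊸ U i) ⊸ (U i ⊸ U i)))
    ⊢step = lam (lam (⊢addOdd i (left (right (∅⊎ ∅)))
                                (ax (suc zero) (U i ⊸ U i)) (ax (suc (suc zero)) (U (suc (suc i))))))

lemma8 : (rest : List (List ℕ)) →
    Σ[ Coerc ∈ Tm (𝒜 rest) 0 ] Σ[ Add ∈ Tm (𝒜 rest) 0 ] Σ[ Square ∈ Tm (𝒜 rest) 0 ]
      (((n : ℕ) → _⇝*_ (𝒜 rest) (app Coerc ⌜ n ⌝) ⌜ n ⌝)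
      × ((n m : ℕ) → _⇝*_ (𝒜 rest) (app (app Add ⌜ n ⌝) ⌜ m ⌝) ⌜ n + m ⌝)
      × ((n : ℕ) → _⇝*_ (𝒜 rest) (app Square ⌜ n ⌝) ⌜ n ^ 2 ⌝)
      × ((i : ℕ) → _⊢_⦂_ (𝒜 rest) (ε (𝒜 rest)) Coerc (U^ (suc i) ⊸ U^ i))
      × ((i : ℕ) → _⊢_⦂_ (𝒜 rest) (ε (𝒜 rest)) Add (U^ (suc i) ⊸ (U^ i ⊸ U^ i)))
      × ((i : ℕ) → _⊢_⦂_ (𝒜 rest) (ε (𝒜 rest)) Square (U^ (suc (suc i)) ⊸ U^ i)))
lemma8 rest = Coerc , Add , Square , Coerc-⌜⌝ , Add-⌜⌝ , Square-⌜⌝ , ⊢Coerc , ⊢Add , ⊢Square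
  where open Arithmetic rest
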